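{- Let $C$ be a subset of an abelian group $G$, and let $\pi : G \to H$ be a surjective group homomorphism onto an abelian group $H$ such that the restriction of $\pi$ to $C$ is injective. If $\pi(C)$ is a minimal complement in $H$, then $C$ is a minimal complement in $G$.
   Context: For a group $K$ and $C \subseteq K$: $C$ is a minimal complement in $K$ if there exists $W \subseteq K$ with $W + C = K$ and $W + C' \neq K$ for every proper subset $C' \subsetneq C$, where $A+B=\{a+b: a\in A, b\in B\}$. -}

module Defs where

open import Level using (Level; _⊔_; suc)
open import Algebra.Bundles using (AbelianGroup)
open import Algebra.Morphism.Structures using (module GroupMorphisms)
open import Data.Product using (Σ; ∃; ∃-syntax; _×_; _,_)
open import Relation.Nullary using (¬_)

module _ {c ℓ : Level} (K : AbelianGroup c ℓ) where
  open AbelianGroup K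

  record Subset : Set (suc (c ⊔ ℓ)) where
    field
      _∈_  : Carrier → Set (c ⊔ ℓ)
      resp : ∀ {x y} → x ≈ y → _∈_ x → _∈_ y
  open Subset public

  _⊆_ : Subset → Subset → Set (c ⊔ ℓ)
  A ⊆ B = ∀ x → (_∈_ A x) → (_∈_ B x)

  _⊊_ : Subset → Subset → Set (c ⊔ ℓ)
  A ⊊ B = (A ⊆ B) × (∃[ x ] ((_∈_ B x) × ¬ (_∈_ A x)))

  -- W + C = K  (the group operation _∙_ of K is written additively in the paper)
  SumsetIsWhole : Subset → Subset → Set (c ⊔ ℓ)
  SumsetIsWhole W C = ∀ k → ∃[ w ] ∃[ x ] ((_∈_ W w) × (_∈_ C x) × ((w ∙ x) ≈ k))

  MinimalComplement : Subset → Set (suc (c ⊔ ℓ))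
  MinimalComplement C =
    Σ Subset λ W → SumsetIsWhole W C × (∀ (C' : Subset) → C' ⊊ C → ¬ SumsetIsWhole W C')

module _ {c ℓ : Level} (G H : AbelianGroup c ℓ) where
  private
    module G = AbelianGroup G
    module H = AbelianGroup H

  IsGroupHomomorphism : (G.Carrier → H.Carrier) → Set (c ⊔ ℓ)
  IsGroupHomomorphism = GroupMorphisms.IsGroupHomomorphism G.rawGroup H.rawGroup

  Surjective : (G.Carrier → H.Carrier) → Set (c ⊔ ℓ)
  Surjective π = ∀ h → ∃[ g ] (π g H.≈ h)

  InjectiveOn : (G.Carrier → H.Carrier) → Subset G → Set (c ⊔ ℓ)
  InjectiveOn π C = ∀ x y → _∈_ C x → _∈_ C y → π x H.≈ π y → x G.≈ y

  image : (π : G.Carrier → H.Carrier) → Subset G → Subset H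
  image π C = record
    { _∈_  = λ h → ∃[ x ] ((_∈_ C x) × (π x H.≈ h))
    ; resp = λ { h≈h' (x , x∈C , πx≈h) → x , x∈C , H.trans πx≈h h≈h' } }

module Submission where

-- A complement W of π(C) pulls back to the complement π⁻¹(W) of C: an element g
-- decomposes as (g − x) + x where π(x) is the π(C)-summand of π(g). Conversely, if
-- π⁻¹(W) + C' = G for some C' ⊊ C, applying the surjection π gives W + π(C') = H,
-- and π(C') ⊊ π(C) because π is injective on C; this contradicts minimality of π(C).

open import Defs
open import Level using (Level)
open import Algebra.Bundles using (AbelianGroup)
open import Algebra.Morphism.Structures using (module GroupMorphisms)
open import Data.Empty using (⊥)
open import Data.Product using (_,_)
import Algebra.Properties.AbelianGroup as AbelianGroupProperties
import Relation.Binary.Reasoning.Setoid as SetoidReasoning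

module Image {c ℓ : Level} (G H : AbelianGroup c ℓ)
             (π : AbelianGroup.Carrier G → AbelianGroup.Carrier H) where
  private
    module H = AbelianGroup H

  image-mono : ∀ {A B : Subset G} → _⊆_ G A B → _⊆_ H (image G H π A) (image G H π B)
  image-mono A⊆B h (x , x∈A , πx≈h) = x , A⊆B x x∈A , πx≈h

  image-mono-strict : ∀ {A B : Subset G} → InjectiveOn G H π B →
                      _⊊_ G A B → _⊊_ H (image G H π A) (image G H π B)
  image-mono-strict {A} {B} inj (A⊆B , b , b∈B , b∉A) =
    image-mono {A} {B} A⊆B , π b , (b , b∈B , H.refl) , πb∉πA
    where
      πb∉πA : Subset._∈_ (image G H π A) (π b) → ⊥
      πb∉πA (a , a∈A , πa≈πb) = b∉A (Subset.resp A (inj a b (A⊆B a a∈A) b∈B πa≈πb) a∈A)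

module Homomorphism {c ℓ : Level} (G H : AbelianGroup c ℓ)
                    {π : AbelianGroup.Carrier G → AbelianGroup.Carrier H}
                    (hom : IsGroupHomomorphism G H π) where
  private
    module G = AbelianGroup G
    module H = AbelianGroup H
    module GP = AbelianGroupProperties G
    module HP = AbelianGroupProperties H
  open GroupMorphisms.IsGroupHomomorphism hom

  preimage : Subset H → Subset G
  preimage W = record
    { _∈_  = λ g → Subset._∈_ W (π g)
    ; resp = λ x≈y → Subset.resp W (⟦⟧-cong x≈y)
    }

  //-homo : ∀ x y → π (x G.- y) H.≈ π x H.- π y
  //-homo x y = H.trans (homo x (y G.⁻¹)) (H.∙-congˡ (⁻¹-homo y))

  preimage-complement : ∀ {W : Subset H} {C : Subset G} →
                        SumsetIsWhole H W (image G H π C) → SumsetIsWhole G (preimage W) C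
  preimage-complement {W} cover g with cover (π g)
  ... | w , h , w∈W , (x , x∈C , πx≈h) , w∙h≈πg =
    g G.- x , x , Subset.resp W w≈π[g-x] w∈W , x∈C , GP.//-rightDividesˡ x g
    where
      open SetoidReasoning H.setoid
      w≈π[g-x] : w H.≈ π (g G.- x)
      w≈π[g-x] = begin
        w            ≈⟨ HP.x≈z//y w h (π g) w∙h≈πg ⟩
        π g H.- h    ≈⟨ H.∙-congˡ (H.⁻¹-cong πx≈h) ⟨
        π g H.- π x  ≈⟨ //-homo g x ⟨
        π (g G.- x)  ∎

  image-complement : Surjective G H π → ∀ {W : Subset H} {C : Subset G} →
                     SumsetIsWhole G (preimage W) C → SumsetIsWhole H W (image G H π C)
  image-complement surj cover h with surj h
  ... | g , πg≈h with cover g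
  ... | w , x , πw∈W , x∈C , w∙x≈g =
    π w , π x , πw∈W , (x , x∈C , H.refl) , πw∙πx≈h
    where
      open SetoidReasoning H.setoid
      πw∙πx≈h : π w H.∙ π x H.≈ h
      πw∙πx≈h = begin
        π w H.∙ π x  ≈⟨ homo w x ⟨
        π (w G.∙ x)  ≈⟨ ⟦⟧-cong w∙x≈g ⟩
        π g          ≈⟨ πg≈h ⟩
        h            ∎

lemma2p2 : {c ℓ : Level} (G H : AbelianGroup c ℓ)
    (π : AbelianGroup.Carrier G → AbelianGroup.Carrier H)
    (C : Subset G) →
    IsGroupHomomorphism G H π →
    Surjective G H π →
    InjectiveOn G H π C →
    MinimalComplement H (image G H π C) →
    MinimalComplement G C
lemma2p2 G H π C hom surj inj (W , cover , minimal) =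
  preimage W , preimage-complement {W} {C} cover , λ C' C'⊊C cover' →
    minimal (image G H π C') (image-mono-strict {C'} {C} inj C'⊊C)
            (image-complement surj {W} {C'} cover')
  where
    open Image G H π
    open Homomorphism G H hom
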